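{- Let $n\ge1$ and let $a_1,\dots,a_n$ be integers with $a_1\ge1$ and $a_i\ge2$ for $i=2,\dots,n$, and assume $(n,a_1)\neq(1,1)$. Then the dual matroid $S^*(a_1,\dots,a_n)$ of the snake $S(a_1,\dots,a_n)$ is isomorphic to the cycle matroid of the multi-fan $F(c',d')$, where \[ c'=\begin{cases}(1,a_2-1,a_4-1,\dots,a_{2k}-1,1) & \text{if } n=2k+1 \text{ and } a_1>1,\\ (1,a_2-1,a_4-1,\dots,a_{2k-2}-1,a_{2k}) & \text{if } n=2k \text{ and } a_1>1,\\ (a_2+1) & \text{if } n=2 \text{ and } a_1=1,\\ (a_2,a_4-1,\dots,a_{2k}-1,1) & \text{if } n=2k+1 \text{ and } a_1=1,\\ (a_2,a_4-1,\dots,a_{2k-2}-1,a_{2k}) & \text{if } n=2k\ge4 \text{ and } a_1=1,\end{cases} \] and \[ d'=\begin{cases}(a_1-1,a_3-1,\dots,a_{2k+1}-1) & \text{if } n=2k+1 \text{ and } a_1>1,\\ (a_1-1,a_3-1,\dots,a_{2k-1}-1) & \text{if } n=2k \text{ and } a_1>1,\\ (a_3-1,a_5-1,\dots,a_{2k+1}-1) & \text{if } n=2k+1 \text{ and } a_1=1,\\ (a_3-1,a_5-1,\dots,a_{2k-1}-1) & \text{if } n=2k \text{ and } a_1=1,\end{cases} \] where empty lists are allowed (e.g. $d'$ is empty when $n=2$, $a_1=1$).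
   Context: Lattice path matroids: for lattice paths $P,Q$ (steps $N=(0,1)$, $E=(1,0)$) from $(0,0)$ to $(m,r)$ with $P$ never above $Q$, encoded by the positions $\{s_1<\dots<s_r\}$ resp. $\{t_1<\dots<t_r\}$ of their North steps, $M[P,Q]$ is the transversal matroid on $\{1,\dots,m+r\}$ with presentation $A_i=\{t_i,\dots,s_i\}$; its bases are the $r$-sets whose lattice path stays in the closed region (diagram) between $P$ and $Q$. Snakes: an LPM is a snake if it has at least two elements, is connected, and its diagram has no interior lattice points. For $a_1\ge1$, $a_i\ge2$ ($i\ge2$), $S(a_1,\dots,a_n)$ is the snake whose diagram, starting at the origin, consists of $a_1$ unit squares to the right, then $a_2$ squares up, then $a_3$ to the right, alternating up to $a_n$, where the last square of each group is the first square of the next. $S(1)$ is the trivial snake. The dual $M^*$ of a matroid $M$ has the complements of the bases of $M$ as bases. Multi-fans: for $\ell\ge1$ and positive integer vectors $c=(c_1,\dots,c_\ell)$, $d=(d_1,\dots,d_{\ell-1})$, $F(c,d)$ is the multigraph formed by a path through vertices $v_1,\dots,v_\ell$ in which $v_i$ and $v_{i+1}$ are joined by a path of $d_i$ edges (through new internal vertices), plus one vertex $x$ joined to each $v_i$ by $c_i$ parallel edges; $F(c_1)$ is a bundle of $c_1$ parallel edges. -}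

module Defs where

open import Data.Nat using (ℕ; zero; suc; _+_; _∸_; _≤_)
open import Data.Bool using (Bool; true; false)
open import Data.List using (List; []; _∷_; _++_; map; replicate; length; take; sum)
open import Data.Product using (Σ; _×_; _,_; proj₁; proj₂)
open import Data.Sum using (_⊎_)
open import Data.Fin using (Fin)
open import Data.Fin.Subset using (Subset; _∈_; _∉_; ∁; ∣_∣; _-_; _∪_; ⁅_⁆)
open import Data.Vec using (tabulate; toList) renaming (lookup to vlookup)
open import Data.List using () renaming (lookup to llookup)
open import Relation.Nullary using (¬_)
open import Relation.Binary.PropositionalEquality using (_≡_)
open import Function.Bundles using (_↔_; _⇔_; Inverse)

record Matroid : Set₁ where
  field
    size    : ℕ
    IsBasis : Subset size → Set
open Matroid public

dual : Matroid → Matroid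
dual M = record { size = size M ; IsBasis = λ B → IsBasis M (∁ B) }

image : ∀ {n m} → Fin n ↔ Fin m → Subset n → Subset m
image σ B = tabulate (λ j → vlookup B (Inverse.from σ j))

_≅_ : Matroid → Matroid → Set
M ≅ N = Σ (Fin (size M) ↔ Fin (size N))
          (λ σ → (B : Subset (size M)) → IsBasis M B ⇔ IsBasis N (image σ B))

-- A lattice path from (0,0) is a word of steps,
-- true = North step N, false = East step E.  A subset B of Fin L is
-- identified with the lattice path whose North steps are at the positions
-- in B.

height : List Bool → ℕ
height []           = 0
height (true ∷ w)   = suc (height w)
height (false ∷ w)  = height w

LPM : (P Q : List Bool) → Matroid
LPM P Q = record
  { size    = length P
  ; IsBasis = λ B →
      (∣ B ∣ ≡ height P) ×
      ((j : ℕ) → j ≤ length P →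
         (height (take j P) ≤ height (take j (toList B))) ×
         (height (take j (toList B)) ≤ height (take j Q)))
  }

-- core word E^{a1-1} N^{a2-1} E^{a3-1} N^{a4-1} ...
-- (Bool argument: the direction of the current group, false = E)
snakeCore : Bool → List ℕ → List Bool
snakeCore b []       = []
snakeCore true  (a ∷ as) = replicate (a ∸ 1) true  ++ snakeCore false as
snakeCore false (a ∷ as) = replicate (a ∸ 1) false ++ snakeCore true as

snakeP snakeQ : List ℕ → List Bool
snakeP as = false ∷ (snakeCore false as ++ (true ∷ []))
snakeQ as = true ∷ (snakeCore false as ++ (false ∷ []))

snake : List ℕ → Matroid
snake as = LPM (snakeP as) (snakeQ as)

Graph : Set
Graph = List (ℕ × ℕ)

Edge : Graph → Set
Edge G = Fin (length G)

ends : (G : Graph) → Edge G → ℕ × ℕ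
ends G e = llookup G e

Adj : ℕ × ℕ → ℕ → ℕ → Set
Adj (a , b) u w = (u ≡ a × w ≡ b) ⊎ (u ≡ b × w ≡ a)

data Reach (G : Graph) (S : Subset (length G)) : ℕ → ℕ → Set where
  here  : ∀ {u} → Reach G S u u
  there : ∀ {u w v} (e : Edge G) → e ∈ S → Adj (ends G e) u w →
          Reach G S w v → Reach G S u v

-- S contains no cycle: no edge of S has its ends joined by S minus it
-- (a loop counts as a cycle)
Acyclic : (G : Graph) → Subset (length G) → Set
Acyclic G S = (e : Edge G) → e ∈ S →
  ¬ Reach G (S - e) (proj₁ (ends G e)) (proj₂ (ends G e))

cycleMatroid : Graph → Matroid
cycleMatroid G = record
  { size    = length G
  ; IsBasis = λ S → Acyclic G S × ((e : Edge G) → e ∉ S → ¬ Acyclic G (S ∪ ⁅ e ⁆))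
  }

-- Multi-fan F(c,d): hub x = 0, v1 = 1, fresh vertices from 2 on.

pathEdges : ℕ → ℕ → ℕ → Graph
pathEdges cur fresh zero    = []
pathEdges cur fresh (suc k) = (cur , fresh) ∷ pathEdges fresh (suc fresh) k

-- cur = current v_i, fresh = next unused vertex label
fanEdges : ℕ → ℕ → List ℕ → List ℕ → Graph
fanEdges cur fresh []       ds        = []
fanEdges cur fresh (c ∷ cs) []        = replicate c (0 , cur)
fanEdges cur fresh (c ∷ cs) (d ∷ ds)  =
  replicate c (0 , cur) ++
  (pathEdges cur fresh d ++ fanEdges (fresh + d ∸ 1) (fresh + d) cs ds)

multiFan : List ℕ → List ℕ → Graph
multiFan c d = fanEdges 1 2 c d

odds evens : List ℕ → List ℕ
odds []       = []
odds (a ∷ as) = a ∷ evens as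
evens []       = []
evens (a ∷ as) = odds as

isOdd : List ℕ → Bool
isOdd []       = false
isOdd (a ∷ as) with isOdd as
... | true  = false
... | false = true

dec : List ℕ → List ℕ
dec = map (λ x → x ∸ 1)

initDec : List ℕ → List ℕ
initDec []           = []
initDec (x ∷ [])     = x ∷ []
initDec (x ∷ y ∷ t)  = (x ∸ 1) ∷ initDec (y ∷ t)

tailL : List ℕ → List ℕ
tailL []       = []
tailL (_ ∷ t)  = t

cPrime : ℕ → List ℕ → List ℕ
cPrime (suc (suc a1)) rest with isOdd (suc (suc a1) ∷ rest)
... | true  = 1 ∷ (dec (evens (suc (suc a1) ∷ rest)) ++ (1 ∷ []))      -- n = 2k+1, a1 > 1
... | false = 1 ∷ initDec (evens (suc (suc a1) ∷ rest))                -- n = 2k,   a1 > 1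
cPrime 1 (a2 ∷ []) = suc a2 ∷ []
cPrime 1 rest with isOdd (1 ∷ rest) | evens (1 ∷ rest)
... | true  | (a2 ∷ e) = a2 ∷ (dec e ++ (1 ∷ []))                      -- n = 2k+1, a1 = 1
... | false | (a2 ∷ e) = a2 ∷ initDec e                                 -- n = 2k≥4, a1 = 1
... | _     | []       = []                                            -- n = 1, a1 = 1 (excluded)
cPrime 0 rest = []                                                      -- a1 = 0 (excluded)

dPrime : ℕ → List ℕ → List ℕ
dPrime (suc (suc a1)) rest = dec (odds (suc (suc a1) ∷ rest))
dPrime 1 rest = dec (tailL (odds (1 ∷ rest)))
dPrime 0 rest = []                                                      -- a1 = 0 (excluded)

-- The dual bases of a snake and the spanning trees of the fan are recognised by the
-- same two-state automaton reading the snake word, North steps being spokes and East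
-- steps rim edges. A dual basis B is the complement of a lattice path which, away from
-- its ends, runs either on the lower boundary or one step above it; each step together
-- with its membership in B keeps, switches or violates this state. An edge set of the
-- fan, read along the same word, is a spanning tree exactly when the current rim vertex
-- is either separated from the hub (and the set spans once the two are identified) or
-- joined to it, and these states evolve by the same rules. The vectors c′ and d′ merely
-- record the run lengths of the snake word.

module Submission where

open import Algebra.Bundles using (CommutativeMonoid)
open import Data.Bool using (Bool; true; false; not; _∧_; _∨_; T)
open import Data.Bool.Properties using (T-∧; T-∨; T-≡; ∧-assoc; ∧-zeroʳ; ∧-commutativeMonoid)
open import Data.Empty using (⊥; ⊥-elim)
open import Data.Fin using (Fin; zero; suc; cast)
open import Data.Fin.Properties using (_≟_; cast-involutive)
open import Data.Fin.Subset using (Subset; _∈_; _∉_; _-_; _─_; _∪_; ⁅_⁆; ∁; ∣_∣; inside; outside)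
open import Data.Fin.Subset.Properties
  using ( x∈p∪q⁻; p⊆p∪q; q⊆p∪q; x∈⁅x⁆; x∈⁅y⁆⇒x≡y; x∈p∧x≢y⇒x∈p-y; p─q⊆p
        ; x∉⁅y⁆⇒x≢y; p─⊥≡p)
open import Data.List using (List; []; _∷_; _++_; length; take; drop; map; replicate)
open import Data.List.Properties using (take-all; length-++; ++-assoc; ++-identityʳ)
open import Data.List.Relation.Unary.All using (All; []; _∷_)
open import Data.Nat using (ℕ; zero; suc; _+_; _∸_; _≤_; _<_; _≤ᵇ_; z≤n; s≤s)
open import Data.Nat.Properties
  using ( >⇒≢; m<n⇒m<1+n; ≤-refl; 1+n≢n; ≤ᵇ⇒≤; ≤⇒≤ᵇ; +-suc; +-identityʳ; n≤1+n
        ; ≤-antisym; ≤-reflexive; suc-injective; <⇒≱)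
open import Data.Product using (_×_; _,_; proj₁; proj₂)
open import Data.Sum using (_⊎_; inj₁; inj₂)
open import Data.Unit using (tt)
open import Data.Vec using (Vec; []; _∷_; toList; tabulate) renaming (lookup to vlookup)
import Data.Vec as Vec
open import Data.Vec.Base using (here; there)
open import Data.Vec.Properties
  using (toList-map; length-toList; tabulate-cong; lookup-cast₂; tabulate∘lookup; toList-cast)
open import Function.Bundles using (_⇔_; _↔_; mk⇔; mk↔ₛ′; Equivalence)
import Function.Properties.Equivalence as ⇔
open import Relation.Nullary using (¬_; yes; no)
open import Relation.Nullary.Decidable using (T?; decidable-stable)
open import Relation.Nullary.Negation using (¬¬-map)
open import Relation.Binary.PropositionalEquality
  using (_≡_; _≢_; refl; sym; trans; cong; cong₂; subst; subst₂; module ≡-Reasoning)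
open import Algebra.Properties.CommutativeSemigroup
  (CommutativeMonoid.commutativeSemigroup ∧-commutativeMonoid) using (x∙yz≈y∙xz)

open import Defs

open Equivalence using (to; from)

-- Walks in multigraphs

Adj-sym : ∀ {e u w} → Adj e u w → Adj e w u
Adj-sym (inj₁ (u≡a , w≡b)) = inj₂ (w≡b , u≡a)
Adj-sym (inj₂ (u≡b , w≡a)) = inj₁ (w≡a , u≡b)

module _ {G : Graph} {S : Subset (length G)} where

  Reach-trans : ∀ {x y z} → Reach G S x y → Reach G S y z → Reach G S x z
  Reach-trans here            q = q
  Reach-trans (there e e∈ a p) q = there e e∈ a (Reach-trans p q)

  edge⇒Reach : ∀ e → e ∈ S → ∀ {u w} → Adj (ends G e) u w → Reach G S u w
  edge⇒Reach e e∈ a = there e e∈ a here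

  Reach-sym : ∀ {x y} → Reach G S x y → Reach G S y x
  Reach-sym here             = here
  Reach-sym (there e e∈ a p) = Reach-trans (Reach-sym p) (edge⇒Reach e e∈ (Adj-sym a))

Reach-map : ∀ {G G′ : Graph} {S : Subset (length G)} {S′ : Subset (length G′)} →
  (∀ e → e ∈ S → ∀ {u w} → Adj (ends G e) u w → Reach G′ S′ u w) →
  ∀ {x y} → Reach G S x y → Reach G′ S′ x y
Reach-map f here             = here
Reach-map f (there e e∈ a p) = Reach-trans (f e e∈ a) (Reach-map f p)

Reach-mono : ∀ {G : Graph} {S S′ : Subset (length G)} → (∀ {e} → e ∈ S → e ∈ S′) →
  ∀ {x y} → Reach G S x y → Reach G S′ x y
Reach-mono S⊆S′ = Reach-map (λ e e∈ → edge⇒Reach e (S⊆S′ e∈))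

-- Reachability once the edge (a , c), present iff b, is added to R: a walk
-- need cross it at most once.
ReachVia : Bool → ℕ × ℕ → (ℕ → ℕ → Set) → ℕ → ℕ → Set
ReachVia b (a , c) R x y = R x y ⊎ (T b × ((R x a × R c y) ⊎ (R x c × R a y)))

module _ {e : ℕ × ℕ} {b : Bool} {G : Graph} {S : Subset (length G)} where

  private
    R = Reach G S

  ReachVia-prepend : ∀ {x w y} → R x w → ReachVia b e R w y → ReachVia b e R x y
  ReachVia-prepend p (inj₁ q)                  = inj₁ (Reach-trans p q)
  ReachVia-prepend p (inj₂ (tb , inj₁ (q , r))) = inj₂ (tb , inj₁ (Reach-trans p q , r))
  ReachVia-prepend p (inj₂ (tb , inj₂ (q , r))) = inj₂ (tb , inj₂ (Reach-trans p q , r))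

  ReachVia-cross : ∀ {x w y} → T b → Adj e x w → ReachVia b e R w y → ReachVia b e R x y
  ReachVia-cross tb (inj₁ (refl , refl)) (inj₁ q)                 = inj₂ (tb , inj₁ (here , q))
  ReachVia-cross tb (inj₁ (refl , refl)) (inj₂ (_ , inj₁ (_ , r))) = inj₂ (tb , inj₁ (here , r))
  ReachVia-cross tb (inj₁ (refl , refl)) (inj₂ (_ , inj₂ (_ , r))) = inj₁ r
  ReachVia-cross tb (inj₂ (refl , refl)) (inj₁ q)                 = inj₂ (tb , inj₂ (here , q))
  ReachVia-cross tb (inj₂ (refl , refl)) (inj₂ (_ , inj₁ (_ , r))) = inj₁ r
  ReachVia-cross tb (inj₂ (refl , refl)) (inj₂ (_ , inj₂ (_ , r))) = inj₂ (tb , inj₂ (here , r))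

Reach-∷⁻ : ∀ {e b G S x y} → Reach (e ∷ G) (b ∷ S) x y → ReachVia b e (Reach G S) x y
Reach-∷⁻ here                          = inj₁ here
Reach-∷⁻ (there zero    here      a p) = ReachVia-cross _ a (Reach-∷⁻ p)
Reach-∷⁻ (there (suc e) (there m) a p) = ReachVia-prepend (edge⇒Reach e m a) (Reach-∷⁻ p)

Reach-weaken : ∀ {e b G S x y} → Reach G S x y → Reach (e ∷ G) (b ∷ S) x y
Reach-weaken = Reach-map (λ e e∈ → edge⇒Reach (suc e) (there e∈))

Reach-∷⁺ : ∀ {e b G S x y} → ReachVia b e (Reach G S) x y → Reach (e ∷ G) (b ∷ S) x y
Reach-∷⁺ (inj₁ p) = Reach-weaken p
Reach-∷⁺ {b = true} (inj₂ (_ , inj₁ (p , q))) =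
  Reach-trans (Reach-weaken p) (Reach-trans (edge⇒Reach zero here (inj₁ (refl , refl))) (Reach-weaken q))
Reach-∷⁺ {b = true} (inj₂ (_ , inj₂ (p , q))) =
  Reach-trans (Reach-weaken p) (Reach-trans (edge⇒Reach zero here (inj₂ (refl , refl))) (Reach-weaken q))

x∈p─q⇒x∉q : ∀ {n} {p q : Subset n} {x} → x ∈ p ─ q → x ∉ q
x∈p─q⇒x∉q {p = inside ∷ p} {outside ∷ q} here      ()
x∈p─q⇒x∉q {p = _ ∷ p}      {outside ∷ q} (there m) (there m′) = x∈p─q⇒x∉q m m′
x∈p─q⇒x∉q {p = _ ∷ p}      {inside ∷ q}  (there m) (there m′) = x∈p─q⇒x∉q m m′

x∈p-y⇒x≢y : ∀ {n} {p : Subset n} {x y} → x ∈ p - y → x ≢ y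
x∈p-y⇒x≢y m = x∉⁅y⁆⇒x≢y (x∈p─q⇒x∉q m)

x∈p-y⇒x∈p : ∀ {n} {p : Subset n} {x y} → x ∈ p - y → x ∈ p
x∈p-y⇒x∈p {p = p} {y = y} = p─q⊆p p ⁅ y ⁆

x∈p∪⁅y⁆-y⇒x∈p : ∀ {n} {p : Subset n} {x y} → x ∈ (p ∪ ⁅ y ⁆) - y → x ∈ p
x∈p∪⁅y⁆-y⇒x∈p {p = p} {y = y} m with x∈p∪q⁻ p ⁅ y ⁆ (x∈p-y⇒x∈p m)
... | inj₁ x∈p = x∈p
... | inj₂ x∈y = ⊥-elim (x∈p-y⇒x≢y m (x∈⁅y⁆⇒x≡y y x∈y))

x∈p∪⁅y⁆-z⇒x∈p-z∪⁅y⁆ : ∀ {n} {p : Subset n} {x y z} →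
  x ∈ (p ∪ ⁅ y ⁆) - z → x ∈ (p - z) ∪ ⁅ y ⁆
x∈p∪⁅y⁆-z⇒x∈p-z∪⁅y⁆ {p = p} {y = y} m with x∈p∪q⁻ p ⁅ y ⁆ (x∈p-y⇒x∈p m)
... | inj₁ x∈p = p⊆p∪q ⁅ y ⁆ (x∈p∧x≢y⇒x∈p-y x∈p (x∈p-y⇒x≢y m))
... | inj₂ x∈y = q⊆p∪q (p - _) ⁅ y ⁆ x∈y

ReachVia-close : ∀ {G : Graph} {S : Subset (length G)} {f b e} → f ∈ S →
  ReachVia b e (Reach G (S - f)) (proj₁ (ends G f)) (proj₂ (ends G f)) →
  Reach G (S - f) (proj₁ (ends G f)) (proj₂ (ends G f)) ⊎ (T b × Reach G S (proj₁ e) (proj₂ e))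
ReachVia-close f∈ (inj₁ r) = inj₁ r
ReachVia-close {f = f} f∈ (inj₂ (tb , inj₁ (p , q))) =
  inj₂ (tb , Reach-trans (Reach-sym (Reach-mono x∈p-y⇒x∈p p))
                (Reach-trans (edge⇒Reach f f∈ (inj₁ (refl , refl))) (Reach-sym (Reach-mono x∈p-y⇒x∈p q))))
ReachVia-close {f = f} f∈ (inj₂ (tb , inj₂ (p , q))) =
  inj₂ (tb , Reach-trans (Reach-mono x∈p-y⇒x∈p q)
                (Reach-trans (edge⇒Reach f f∈ (inj₂ (refl , refl))) (Reach-mono x∈p-y⇒x∈p p)))

module _ {a c : ℕ} {G : Graph} {S : Subset (length G)} where

  Acyclic-∷⁻ : ∀ {b} → Acyclic ((a , c) ∷ G) (b ∷ S) → Acyclic G S × (T b → ¬ Reach G S a c)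
  Acyclic-∷⁻ {b} ac = (λ f f∈ r → ac (suc f) (there f∈) (Reach-weaken r)) , closes b ac
    where
    closes : ∀ b → Acyclic ((a , c) ∷ G) (b ∷ S) → T b → ¬ Reach G S a c
    closes true ac _ r = ac zero here (Reach-weaken (subst (λ U → Reach G U a c) (sym (p─⊥≡p S)) r))

  Acyclic-∷⁺ : ∀ {b} → Acyclic G S → (T b → ¬ Reach G S a c) → Acyclic ((a , c) ∷ G) (b ∷ S)
  Acyclic-∷⁺ acG closes zero here r with Reach-∷⁻ r
  ... | inj₁ r′ = closes _ (subst (λ U → Reach G U a c) (p─⊥≡p S) r′)
  ... | inj₂ (() , _)
  Acyclic-∷⁺ acG closes (suc f) (there f∈) r with ReachVia-close f∈ (Reach-∷⁻ r)
  ... | inj₁ r′        = acG f f∈ r′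
  ... | inj₂ (tb , r′) = closes tb r′

Reach-∪⁅⁆⁻ : ∀ {G : Graph} {S : Subset (length G)} {e x y} → Reach G (S ∪ ⁅ e ⁆) x y →
  ReachVia true (ends G e) (Reach G S) x y
Reach-∪⁅⁆⁻ here = inj₁ here
Reach-∪⁅⁆⁻ {S = S} {e} (there f f∈ a r) with x∈p∪q⁻ S ⁅ e ⁆ f∈
... | inj₁ f∈S = ReachVia-prepend (edge⇒Reach f f∈S a) (Reach-∪⁅⁆⁻ r)
... | inj₂ f∈e with x∈⁅y⁆⇒x≡y e f∈e
...   | refl = ReachVia-cross _ a (Reach-∪⁅⁆⁻ r)

-- Double negation: maximality of an acyclic set only refutes the absence of a walk.
Spanning : (G : Graph) → Subset (length G) → Set
Spanning G S = ∀ e → e ∉ S → ¬ ¬ Reach G S (proj₁ (ends G e)) (proj₂ (ends G e))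

module _ {G : Graph} {S : Subset (length G)} where

  maximal⇒Spanning : Acyclic G S → (∀ e → e ∉ S → ¬ Acyclic G (S ∪ ⁅ e ⁆)) → Spanning G S
  maximal⇒Spanning acG maximal e e∉S disconnected = maximal e e∉S acyclic
    where
    acyclic : Acyclic G (S ∪ ⁅ e ⁆)
    acyclic f f∈ r with f ≟ e
    ... | yes refl = disconnected (Reach-mono x∈p∪⁅y⁆-y⇒x∈p r)
    ... | no f≢e with x∈p∪q⁻ S ⁅ e ⁆ f∈
    ...   | inj₂ f∈e = f≢e (x∈⁅y⁆⇒x≡y e f∈e)
    ...   | inj₁ f∈S with ReachVia-close f∈S (Reach-∪⁅⁆⁻ (Reach-mono x∈p∪⁅y⁆-z⇒x∈p-z∪⁅y⁆ r))
    ...     | inj₁ r′      = acG f f∈S r′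
    ...     | inj₂ (_ , r′) = disconnected r′

  Spanning⇒maximal : Spanning G S → ∀ e → e ∉ S → ¬ Acyclic G (S ∪ ⁅ e ⁆)
  Spanning⇒maximal spanning e e∉S ac =
    spanning e e∉S (λ r → ac e (q⊆p∪q S ⁅ e ⁆ (x∈⁅x⁆ e)) (Reach-mono S⊆S∪e-e r))
    where
    S⊆S∪e-e : ∀ {x} → x ∈ S → x ∈ (S ∪ ⁅ e ⁆) - e
    S⊆S∪e-e x∈S = x∈p∧x≢y⇒x∈p-y (p⊆p∪q ⁅ e ⁆ x∈S) (λ { refl → e∉S x∈S })

-- Fans

-- In a fan word, true is a spoke from the hub 0 to the current rim vertex v
-- and false a rim edge from v to the next rim vertex v + 1.
fanGraph : ℕ → List Bool → Graph
fanGraph v []          = []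
fanGraph v (true  ∷ w) = (0 , v) ∷ fanGraph v w
fanGraph v (false ∷ w) = (v , suc v) ∷ fanGraph (suc v) w

Isolated : ℕ → Graph → Set
Isolated z G = ∀ e → proj₁ (ends G e) ≢ z × proj₂ (ends G e) ≢ z

Isolated⇒Reach≡ : ∀ {G z y} {S : Subset (length G)} → Isolated z G → Reach G S z y → y ≡ z
Isolated⇒Reach≡ iso here                            = refl
Isolated⇒Reach≡ iso (there e _ (inj₁ (z≡a , _)) _) = ⊥-elim (proj₁ (iso e) (sym z≡a))
Isolated⇒Reach≡ iso (there e _ (inj₂ (z≡b , _)) _) = ⊥-elim (proj₂ (iso e) (sym z≡b))

fanGraph-isolated : ∀ {z} v w → z ≢ 0 → z < v → Isolated z (fanGraph v w)
fanGraph-isolated v (true  ∷ w) z≢0 z<v zero    = (λ 0≡z → z≢0 (sym 0≡z)) , >⇒≢ z<v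
fanGraph-isolated v (true  ∷ w) z≢0 z<v (suc e) = fanGraph-isolated v w z≢0 z<v e
fanGraph-isolated v (false ∷ w) z≢0 z<v zero    = >⇒≢ z<v , >⇒≢ (m<n⇒m<1+n z<v)
fanGraph-isolated v (false ∷ w) z≢0 z<v (suc e) = fanGraph-isolated (suc v) w z≢0 (m<n⇒m<1+n z<v) e

rim-isolated : ∀ {v} w → v ≢ 0 → Isolated v (fanGraph (suc v) w)
rim-isolated w v≢0 = fanGraph-isolated _ w v≢0 ≤-refl

Reach-∷-absent : ∀ {e G S x y} → Reach (e ∷ G) (false ∷ S) x y → Reach G S x y
Reach-∷-absent r with Reach-∷⁻ r
... | inj₁ r′ = r′

T-nand⁺ : ∀ {x y} → (T x → T y → ⊥) → T (not (x ∧ y))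
T-nand⁺ {false}         _ = tt
T-nand⁺ {true} {false} _ = tt
T-nand⁺ {true} {true}  f = f tt tt

T-nand⁻ : ∀ {x y} → T (not (x ∧ y)) → T x → T y → ⊥
T-nand⁻ {true} {true} ()

-- s, the membership word of an edge set, joins the hub to the current rim vertex.
linksHub : List Bool → List Bool → Bool
linksHub (true  ∷ w) (b ∷ s) = b ∨ linksHub w s
linksHub (false ∷ w) (b ∷ s) = b ∧ linksHub w s
linksHub _           _       = false

acyclicᵇ : List Bool → List Bool → Bool
acyclicᵇ (true  ∷ w) (b ∷ s) = not (b ∧ linksHub w s) ∧ acyclicᵇ w s
acyclicᵇ (false ∷ w) (b ∷ s) = acyclicᵇ w s
acyclicᵇ _           _       = true

-- β records a virtual spoke to the current rim vertex.
spansᵇ : Bool → List Bool → List Bool → Bool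
spansᵇ β (true  ∷ w) (b ∷ s) = (b ∨ (β ∨ linksHub w s)) ∧ spansᵇ (β ∨ b) w s
spansᵇ β (false ∷ w) (b ∷ s) = (b ∨ (β ∧ linksHub w s)) ∧ spansᵇ (β ∧ b) w s
spansᵇ β _           _       = true

linksHub-sound : ∀ v w (S : Subset (length (fanGraph v w))) →
  T (linksHub w (toList S)) → Reach (fanGraph v w) S 0 v
linksHub-sound v []          []          ()
linksHub-sound v (true  ∷ w) (true  ∷ S) _ = edge⇒Reach zero here (inj₁ (refl , refl))
linksHub-sound v (true  ∷ w) (false ∷ S) l = Reach-weaken (linksHub-sound v w S l)
linksHub-sound v (false ∷ w) (true  ∷ S) l = Reach-∷⁺ (inj₂ (_ , inj₂ (linksHub-sound (suc v) w S l , here)))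
linksHub-sound v (false ∷ w) (false ∷ S) ()

linksHub-complete : ∀ v w (S : Subset (length (fanGraph v w))) → v ≢ 0 →
  Reach (fanGraph v w) S 0 v → T (linksHub w (toList S))
linksHub-complete v [] [] v≢0 r = v≢0 (Isolated⇒Reach≡ (λ ()) r)
linksHub-complete v (true ∷ w) (b ∷ S) v≢0 r with Reach-∷⁻ r
... | inj₁ r′      = from T-∨ (inj₂ (linksHub-complete v w S v≢0 r′))
... | inj₂ (tb , _) = from T-∨ (inj₁ tb)
linksHub-complete v (false ∷ w) (b ∷ S) v≢0 r with Reach-∷⁻ r
... | inj₁ r′                 = ⊥-elim (v≢0 (sym (Isolated⇒Reach≡ (rim-isolated w v≢0) (Reach-sym r′))))
... | inj₂ (_ , inj₁ (r′ , _)) = ⊥-elim (v≢0 (sym (Isolated⇒Reach≡ (rim-isolated w v≢0) (Reach-sym r′))))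
... | inj₂ (tb , inj₂ (r′ , _)) = from T-∧ (tb , linksHub-complete (suc v) w S (λ ()) r′)

acyclicᵇ-complete : ∀ v w (S : Subset (length (fanGraph v w))) →
  Acyclic (fanGraph v w) S → T (acyclicᵇ w (toList S))
acyclicᵇ-complete v [] [] _ = tt
acyclicᵇ-complete v (true ∷ w) (b ∷ S) ac with Acyclic-∷⁻ ac
... | acG , closes = from T-∧ ( T-nand⁺ {b} (λ tb l → closes tb (linksHub-sound v w S l))
                               , acyclicᵇ-complete v w S acG)
acyclicᵇ-complete v (false ∷ w) (b ∷ S) ac = acyclicᵇ-complete (suc v) w S (proj₁ (Acyclic-∷⁻ ac))

acyclicᵇ-sound : ∀ v w (S : Subset (length (fanGraph v w))) → v ≢ 0 →
  T (acyclicᵇ w (toList S)) → Acyclic (fanGraph v w) S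
acyclicᵇ-sound v [] [] _ _ ()
acyclicᵇ-sound v (true ∷ w) (b ∷ S) v≢0 a with to T-∧ a
... | nand , a′ = Acyclic-∷⁺ (acyclicᵇ-sound v w S v≢0 a′)
                    (λ tb r → T-nand⁻ nand tb (linksHub-complete v w S v≢0 r))
acyclicᵇ-sound v (false ∷ w) (b ∷ S) v≢0 a = Acyclic-∷⁺ (acyclicᵇ-sound (suc v) w S (λ ()) a)
  (λ _ r → 1+n≢n (Isolated⇒Reach≡ (rim-isolated w v≢0) r))

module _ {e : ℕ × ℕ} {G : Graph} {S : Subset (length G)} where

  Reach-parallel⁻ : ∀ {β b x y} →
    Reach (e ∷ e ∷ G) (β ∷ b ∷ S) x y → Reach (e ∷ G) ((β ∨ b) ∷ S) x y
  Reach-parallel⁻ {β} {b} = Reach-map (merge β b)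
    where
    merge : ∀ β b f → f ∈ β ∷ b ∷ S → ∀ {u w} → Adj (ends (e ∷ e ∷ G) f) u w →
            Reach (e ∷ G) ((β ∨ b) ∷ S) u w
    merge true  b     zero          here              a = edge⇒Reach zero here a
    merge true  true  (suc zero)    (there here)      a = edge⇒Reach zero here a
    merge false true  (suc zero)    (there here)      a = edge⇒Reach zero here a
    merge β     b     (suc (suc f)) (there (there m)) a = edge⇒Reach (suc f) (there m) a

  Reach-parallel⁺ : ∀ {β b x y} →
    Reach (e ∷ G) ((β ∨ b) ∷ S) x y → Reach (e ∷ e ∷ G) (β ∷ b ∷ S) x y
  Reach-parallel⁺ {β} {b} = Reach-map (split β b)
    where
    split : ∀ β b f → f ∈ (β ∨ b) ∷ S → ∀ {u w} → Adj (ends (e ∷ G) f) u w →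
            Reach (e ∷ e ∷ G) (β ∷ b ∷ S) u w
    split true  b    zero    here      a = edge⇒Reach zero here a
    split false true zero    here      a = edge⇒Reach (suc zero) (there here) a
    split β     b    (suc f) (there m) a = edge⇒Reach (suc (suc f)) (there (there m)) a

module _ {v : ℕ} {G : Graph} {S : Subset (length G)} where

  Reach-series⁺ : ∀ {β b x y} → Reach ((0 , suc v) ∷ G) ((β ∧ b) ∷ S) x y →
    Reach ((0 , v) ∷ (v , suc v) ∷ G) (β ∷ b ∷ S) x y
  Reach-series⁺ {β} {b} = Reach-map (unfold β b)
    where
    hub-to-next : Reach ((0 , v) ∷ (v , suc v) ∷ G) (true ∷ true ∷ S) 0 (suc v)
    hub-to-next = Reach-trans (edge⇒Reach zero here (inj₁ (refl , refl)))
                              (edge⇒Reach (suc zero) (there here) (inj₁ (refl , refl)))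
    unfold : ∀ β b f → f ∈ (β ∧ b) ∷ S → ∀ {u w} → Adj (ends ((0 , suc v) ∷ G) f) u w →
             Reach ((0 , v) ∷ (v , suc v) ∷ G) (β ∷ b ∷ S) u w
    unfold true true zero    here      (inj₁ (refl , refl)) = hub-to-next
    unfold true true zero    here      (inj₂ (refl , refl)) = Reach-sym hub-to-next
    unfold β    b    (suc f) (there m) a                    = edge⇒Reach (suc (suc f)) (there (there m)) a

  module _ (v≢0 : v ≢ 0) (iso : Isolated v G) where

    private
      Reach-rim-avoiding : ∀ {b x y} → x ≢ v → y ≢ v → Reach ((v , suc v) ∷ G) (b ∷ S) x y → Reach G S x y
      Reach-rim-avoiding x≢v y≢v r with Reach-∷⁻ r
      ... | inj₁ r′                = r′
      ... | inj₂ (_ , inj₁ (p , _)) = ⊥-elim (x≢v (Isolated⇒Reach≡ iso (Reach-sym p)))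
      ... | inj₂ (_ , inj₂ (_ , q)) = ⊥-elim (y≢v (Isolated⇒Reach≡ iso q))

      Reach-rim-into : ∀ {b x} → x ≢ v → Reach ((v , suc v) ∷ G) (b ∷ S) x v → T b × Reach G S x (suc v)
      Reach-rim-into x≢v r with Reach-∷⁻ r
      ... | inj₁ r′                 = ⊥-elim (x≢v (Isolated⇒Reach≡ iso (Reach-sym r′)))
      ... | inj₂ (_ , inj₁ (p , _))  = ⊥-elim (x≢v (Isolated⇒Reach≡ iso (Reach-sym p)))
      ... | inj₂ (tb , inj₂ (p , _)) = tb , p

      0≢v : 0 ≢ v
      0≢v 0≡v = v≢0 (sym 0≡v)

    -- The spoke (0 , v) and the rim edge (v , suc v) are in series when v is otherwise isolated.
    Reach-series⁻ : ∀ {β b x y} → x ≢ v → y ≢ v →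
      Reach ((0 , v) ∷ (v , suc v) ∷ G) (β ∷ b ∷ S) x y →
      Reach ((0 , suc v) ∷ G) ((β ∧ b) ∷ S) x y
    Reach-series⁻ x≢v y≢v r with Reach-∷⁻ r
    ... | inj₁ r′ = Reach-weaken (Reach-rim-avoiding x≢v y≢v r′)
    ... | inj₂ (tβ , inj₁ (p , q)) with Reach-rim-into y≢v (Reach-sym q)
    ...   | tb , q′ =
      Reach-∷⁺ (inj₂ (from T-∧ (tβ , tb) , inj₁ (Reach-rim-avoiding x≢v 0≢v p , Reach-sym q′)))
    Reach-series⁻ x≢v y≢v r | inj₂ (tβ , inj₂ (p , q)) with Reach-rim-into x≢v p
    ...   | tb , p′ = Reach-∷⁺ (inj₂ (from T-∧ (tβ , tb) , inj₂ (p′ , Reach-rim-avoiding 0≢v y≢v q)))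

SpansWith : Bool → ∀ v w → Subset (length (fanGraph v w)) → Set
SpansWith β v w S = ∀ f → f ∉ S →
  ¬ ¬ Reach ((0 , v) ∷ fanGraph v w) (β ∷ S) (proj₁ (ends (fanGraph v w) f)) (proj₂ (ends (fanGraph v w) f))

T-stable : ∀ {b} → ¬ ¬ T b → T b
T-stable {b} = decidable-stable (T? b)

spansᵇ-complete : ∀ β v w (S : Subset (length (fanGraph v w))) → v ≢ 0 →
  SpansWith β v w S → T (spansᵇ β w (toList S))
spansᵇ-complete β v [] [] _ _ = tt
spansᵇ-complete β v (true ∷ w) (b ∷ S) v≢0 sp =
  from T-∧ (spoke-covered β b sp , spansᵇ-complete (β ∨ b) v w S v≢0 rest)
  where
  spoke-covered : ∀ β b → SpansWith β v (true ∷ w) (b ∷ S) → T (b ∨ (β ∨ linksHub w (toList S)))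
  spoke-covered β     true  _  = tt
  spoke-covered true  false _  = tt
  spoke-covered false false sp =
    T-stable (¬¬-map (λ r → linksHub-complete v w S v≢0 (Reach-∷-absent (Reach-parallel⁻ r))) (sp zero (λ ())))
  rest : SpansWith (β ∨ b) v w S
  rest f f∉ = ¬¬-map Reach-parallel⁻ (sp (suc f) (λ { (there m) → f∉ m }))
spansᵇ-complete β v (false ∷ w) (b ∷ S) v≢0 sp =
  from T-∧ (rim-covered b sp , spansᵇ-complete (β ∧ b) (suc v) w S (λ ()) rest)
  where
  iso = rim-isolated w v≢0
  through-hub : Reach ((0 , v) ∷ fanGraph v (false ∷ w)) (β ∷ false ∷ S) v (suc v) →
                T (β ∧ linksHub w (toList S))
  through-hub r with Reach-∷⁻ r
  ... | inj₁ r′                  = ⊥-elim (1+n≢n (Isolated⇒Reach≡ iso (Reach-∷-absent r′)))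
  ... | inj₂ (_ , inj₁ (_ , q))  = ⊥-elim (1+n≢n (Isolated⇒Reach≡ iso (Reach-∷-absent q)))
  ... | inj₂ (tβ , inj₂ (_ , q)) = from T-∧ (tβ , linksHub-complete (suc v) w S (λ ()) (Reach-∷-absent q))
  rim-covered : ∀ b → SpansWith β v (false ∷ w) (b ∷ S) → T (b ∨ (β ∧ linksHub w (toList S)))
  rim-covered true  _  = tt
  rim-covered false sp = T-stable (¬¬-map through-hub (sp zero (λ ())))
  rest : SpansWith (β ∧ b) (suc v) w S
  rest f f∉ = ¬¬-map (Reach-series⁻ v≢0 iso (proj₁ (iso f)) (proj₂ (iso f)))
                     (sp (suc f) (λ { (there m) → f∉ m }))

spansᵇ-sound : ∀ β v w (S : Subset (length (fanGraph v w))) →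
  T (spansᵇ β w (toList S)) → SpansWith β v w S
spansᵇ-sound β v [] [] _ ()
spansᵇ-sound β     v (true ∷ w) (true  ∷ S) _ zero f∉ = ⊥-elim (f∉ here)
spansᵇ-sound true  v (true ∷ w) (false ∷ S) _ zero _  k =
  k (Reach-parallel⁺ (edge⇒Reach zero here (inj₁ (refl , refl))))
spansᵇ-sound false v (true ∷ w) (false ∷ S) p zero _  k =
  k (Reach-parallel⁺ (Reach-weaken (linksHub-sound v w S (proj₁ (to T-∧ p)))))
spansᵇ-sound β v (true ∷ w) (b ∷ S) p (suc f) f∉ =
  ¬¬-map Reach-parallel⁺ (spansᵇ-sound (β ∨ b) v w S (proj₂ (to T-∧ p)) f (λ m → f∉ (there m)))
spansᵇ-sound β     v (false ∷ w) (true  ∷ S) _ zero f∉ = ⊥-elim (f∉ here)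
spansᵇ-sound true  v (false ∷ w) (false ∷ S) p zero _  k =
  k (Reach-trans (edge⇒Reach zero here (inj₂ (refl , refl)))
                 (Reach-weaken (Reach-weaken (linksHub-sound (suc v) w S (proj₁ (to T-∧ p))))))
spansᵇ-sound false v (false ∷ w) (false ∷ S) () zero
spansᵇ-sound β v (false ∷ w) (b ∷ S) p (suc f) f∉ =
  ¬¬-map Reach-series⁺ (spansᵇ-sound (β ∧ b) (suc v) w S (proj₂ (to T-∧ p)) f (λ m → f∉ (there m)))

fanBasisᵇ : List Bool → List Bool → Bool
fanBasisᵇ w s = acyclicᵇ w s ∧ spansᵇ false w s

fanGraph-basis : ∀ w (S : Subset (length (fanGraph 1 w))) →
  IsBasis (cycleMatroid (fanGraph 1 w)) S ⇔ T (fanBasisᵇ w (toList S))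
fanGraph-basis w S = mk⇔ basis⇒ basis⇐
  where
  basis⇒ : IsBasis (cycleMatroid (fanGraph 1 w)) S → T (fanBasisᵇ w (toList S))
  basis⇒ (ac , maximal) = from T-∧
    ( acyclicᵇ-complete 1 w S ac
    , spansᵇ-complete false 1 w S (λ ())
        (λ f f∉ → ¬¬-map Reach-weaken (maximal⇒Spanning ac maximal f f∉)))
  basis⇐ : T (fanBasisᵇ w (toList S)) → IsBasis (cycleMatroid (fanGraph 1 w)) S
  basis⇐ p =
    acyclicᵇ-sound 1 w S (λ ()) (proj₁ (to T-∧ p)) ,
    Spanning⇒maximal (λ f f∉ → ¬¬-map Reach-∷-absent (spansᵇ-sound false 1 w S (proj₂ (to T-∧ p)) f f∉))

-- The snake automaton

-- For the snake, a side records whether the complementary lattice path runs along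
-- the lower boundary P or one step above it; for the fan, whether the current rim
-- vertex is still separated from the hub or already joined to it.
data Side : Set where
  lower upper : Side

accepting : Side → Bool
accepting lower = true
accepting upper = false

-- Reads a snake word (true is a North step, i.e. a spoke) along a membership word.
snakeRun : Side → List Bool → List Bool → Bool
snakeRun lower (false ∷ w) (true  ∷ s) = snakeRun lower w s
snakeRun lower (false ∷ w) (false ∷ s) = snakeRun upper w s
snakeRun lower (true  ∷ w) (true  ∷ s) = false
snakeRun lower (true  ∷ w) (false ∷ s) = snakeRun lower w s
snakeRun upper (false ∷ w) (true  ∷ s) = snakeRun upper w s
snakeRun upper (false ∷ w) (false ∷ s) = false
snakeRun upper (true  ∷ w) (true  ∷ s) = snakeRun lower w s
snakeRun upper (true  ∷ w) (false ∷ s) = snakeRun upper w s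
snakeRun side  _           _           = accepting side

startSide : Bool → Side
startSide true  = lower
startSide false = upper

fanStateᵇ : Side → List Bool → List Bool → Bool
fanStateᵇ lower w s = not (linksHub w s) ∧ (acyclicᵇ w s ∧ spansᵇ true w s)
fanStateᵇ upper w s = linksHub w s ∧ (acyclicᵇ w s ∧ spansᵇ false w s)

∧-duplicateʳ : ∀ x y z → x ∧ (y ∧ (x ∧ z)) ≡ x ∧ (y ∧ z)
∧-duplicateʳ true  y z = refl
∧-duplicateʳ false y z = refl

fanStateᵇ≡snakeRun : ∀ side w s → fanStateᵇ side w s ≡ snakeRun side w s
fanStateᵇ≡snakeRun lower (false ∷ w) (true  ∷ s) = fanStateᵇ≡snakeRun lower w s
fanStateᵇ≡snakeRun lower (false ∷ w) (false ∷ s) =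
  trans (x∙yz≈y∙xz (acyclicᵇ w s) (linksHub w s) (spansᵇ false w s)) (fanStateᵇ≡snakeRun upper w s)
fanStateᵇ≡snakeRun lower (true  ∷ w) (true  ∷ s) = refl
fanStateᵇ≡snakeRun lower (true  ∷ w) (false ∷ s) = fanStateᵇ≡snakeRun lower w s
fanStateᵇ≡snakeRun upper (false ∷ w) (true  ∷ s) = fanStateᵇ≡snakeRun upper w s
fanStateᵇ≡snakeRun upper (false ∷ w) (false ∷ s) = refl
fanStateᵇ≡snakeRun upper (true  ∷ w) (true  ∷ s) =
  trans (∧-assoc (not (linksHub w s)) (acyclicᵇ w s) (spansᵇ true w s)) (fanStateᵇ≡snakeRun lower w s)
fanStateᵇ≡snakeRun upper (true  ∷ w) (false ∷ s) =
  trans (∧-duplicateʳ (linksHub w s) (acyclicᵇ w s) (spansᵇ false w s)) (fanStateᵇ≡snakeRun upper w s)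
fanStateᵇ≡snakeRun lower []      _  = refl
fanStateᵇ≡snakeRun lower (true  ∷ _) [] = refl
fanStateᵇ≡snakeRun lower (false ∷ _) [] = refl
fanStateᵇ≡snakeRun upper []      _  = refl
fanStateᵇ≡snakeRun upper (true  ∷ _) [] = refl
fanStateᵇ≡snakeRun upper (false ∷ _) [] = refl

fanBasisᵇ-spoke : ∀ w b s → fanBasisᵇ (true ∷ w) (b ∷ s) ≡ snakeRun (startSide b) w s
fanBasisᵇ-spoke w true  s =
  trans (∧-assoc (not (linksHub w s)) (acyclicᵇ w s) (spansᵇ true w s)) (fanStateᵇ≡snakeRun lower w s)
fanBasisᵇ-spoke w false s =
  trans (x∙yz≈y∙xz (acyclicᵇ w s) (linksHub w s) (spansᵇ false w s)) (fanStateᵇ≡snakeRun upper w s)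

-- Lattice paths

stepHeight : Bool → ℕ → ℕ
stepHeight true  n = suc n
stepHeight false n = n

between : ℕ → ℕ → ℕ → Bool
between p c q = (p ≤ᵇ c) ∧ (c ≤ᵇ q)

hd : List Bool → Bool
hd []      = false
hd (x ∷ _) = x

-- A missing step of C or Q counts as an East step, as it does under take.
withinᵇ : ℕ → ℕ → ℕ → List Bool → List Bool → List Bool → Bool
withinᵇ p c q []      C Q = between p c q
withinᵇ p c q (x ∷ P) C Q =
  between p c q ∧ withinᵇ (stepHeight x p) (stepHeight (hd C) c) (stepHeight (hd Q) q) P (drop 1 C) (drop 1 Q)

Within : ℕ → ℕ → ℕ → List Bool → List Bool → List Bool → Set
Within p c q P C Q = (j : ℕ) → j ≤ length P →
  (p + height (take j P) ≤ c + height (take j C)) × (c + height (take j C) ≤ q + height (take j Q))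

T-between : ∀ {p c q} → T (between p c q) ⇔ ((p ≤ c) × (c ≤ q))
T-between {p} {c} {q} = mk⇔
  (λ t → let (pc , cq) = to T-∧ t in ≤ᵇ⇒≤ p c pc , ≤ᵇ⇒≤ c q cq)
  (λ (pc , cq) → from T-∧ (≤⇒≤ᵇ pc , ≤⇒≤ᵇ cq))

+-height-take-suc : ∀ p j L → p + height (take (suc j) L) ≡ stepHeight (hd L) p + height (take j (drop 1 L))
+-height-take-suc p zero    []          = refl
+-height-take-suc p (suc j) []          = refl
+-height-take-suc p j       (true  ∷ L) = +-suc p (height (take j L))
+-height-take-suc p j       (false ∷ L) = refl

Within-head : ∀ {p c q P C Q} → Within p c q P C Q → (p ≤ c) × (c ≤ q)
Within-head {p} {c} {q} w = let (pc , cq) = w 0 z≤n in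
  subst₂ _≤_ (+-identityʳ p) (+-identityʳ c) pc , subst₂ _≤_ (+-identityʳ c) (+-identityʳ q) cq

bounds-+0 : ∀ {p c q} → (p ≤ c) × (c ≤ q) → (p + 0 ≤ c + 0) × (c + 0 ≤ q + 0)
bounds-+0 {p} {c} {q} (pc , cq) =
  subst₂ _≤_ (sym (+-identityʳ p)) (sym (+-identityʳ c)) pc ,
  subst₂ _≤_ (sym (+-identityʳ c)) (sym (+-identityʳ q)) cq

Within-tail : ∀ {p c q x P} C Q → Within p c q (x ∷ P) C Q →
  Within (stepHeight x p) (stepHeight (hd C) c) (stepHeight (hd Q) q) P (drop 1 C) (drop 1 Q)
Within-tail {p} {c} {q} {x} {P} C Q w j j≤ = let (pc , cq) = w (suc j) (s≤s j≤) in
  subst₂ _≤_ (+-height-take-suc p j (x ∷ P)) (+-height-take-suc c j C) pc ,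
  subst₂ _≤_ (+-height-take-suc c j C) (+-height-take-suc q j Q) cq

withinᵇ-complete : ∀ {p c q} P C Q → Within p c q P C Q → T (withinᵇ p c q P C Q)
withinᵇ-complete []      C Q w = from T-between (Within-head w)
withinᵇ-complete (x ∷ P) C Q w =
  from T-∧ (from T-between (Within-head w) , withinᵇ-complete P (drop 1 C) (drop 1 Q) (Within-tail C Q w))

withinᵇ-sound : ∀ {p c q} P C Q → T (withinᵇ p c q P C Q) → Within p c q P C Q
withinᵇ-sound []      C Q t zero    _        = bounds-+0 (to T-between t)
withinᵇ-sound (x ∷ P) C Q t zero    _        = bounds-+0 (to T-between (proj₁ (to T-∧ t)))
withinᵇ-sound {p} {c} {q} (x ∷ P) C Q t (suc j) (s≤s j≤)
  with withinᵇ-sound P (drop 1 C) (drop 1 Q) (proj₂ (to T-∧ t)) j j≤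
... | pc , cq =
  subst₂ _≤_ (sym (+-height-take-suc p j (x ∷ P))) (sym (+-height-take-suc c j C)) pc ,
  subst₂ _≤_ (sym (+-height-take-suc c j C)) (sym (+-height-take-suc q j Q)) cq

≤ᵇ-true : ∀ {m n} → m ≤ n → (m ≤ᵇ n) ≡ true
≤ᵇ-true m≤n = to T-≡ (≤⇒≤ᵇ m≤n)

≤ᵇ-false : ∀ {m n} → n < m → (m ≤ᵇ n) ≡ false
≤ᵇ-false {m} {n} n<m = ¬T-≡false (λ t → <⇒≱ n<m (≤ᵇ⇒≤ m n t))
  where
  ¬T-≡false : ∀ {b} → ¬ T b → b ≡ false
  ¬T-≡false {false} _ = refl
  ¬T-≡false {true}  f with f _
  ... | ()

true-∧ : ∀ {x y} → x ≡ true → (x ∧ y) ≡ y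
true-∧ refl = refl

false-∧ : ∀ {x y} → x ≡ false → (x ∧ y) ≡ false
false-∧ refl = refl

level : Side → ℕ → ℕ
level lower p = p
level upper p = suc p

between-level : ∀ side p → between p (level side p) (suc p) ≡ true
between-level lower p = cong₂ _∧_ (≤ᵇ-true (≤-refl {p})) (≤ᵇ-true (n≤1+n p))
between-level upper p = cong₂ _∧_ (≤ᵇ-true (n≤1+n p)) (≤ᵇ-true (≤-refl {suc p}))

between-refl : ∀ p → between p p p ≡ true
between-refl p = cong₂ _∧_ (≤ᵇ-true (≤-refl {p})) (≤ᵇ-true (≤-refl {p}))

between-under : ∀ p q → between (suc p) p q ≡ false
between-under p q = false-∧ (≤ᵇ-false (≤-refl {suc p}))

between-over : ∀ p q → between p (suc q) q ≡ false
between-over p q = trans (cong ((p ≤ᵇ suc q) ∧_) (≤ᵇ-false (≤-refl {suc q}))) (∧-zeroʳ (p ≤ᵇ suc q))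

withinᵇ-fails : ∀ {p c q} P C Q → between p c q ≡ false → withinᵇ p c q P C Q ≡ false
withinᵇ-fails []      C Q out = out
withinᵇ-fails (x ∷ P) C Q out = false-∧ out

withinᵇ-snake : ∀ side core p (t : List Bool) → length t ≡ length (core ++ true ∷ []) →
  withinᵇ p (level side p) (suc p) (core ++ true ∷ []) (map not t) (core ++ false ∷ [])
    ≡ snakeRun side (core ++ true ∷ []) t
withinᵇ-snake lower [] p (true  ∷ []) _ = trans (true-∧ (between-level lower p)) (between-under p (suc p))
withinᵇ-snake lower [] p (false ∷ []) _ = trans (true-∧ (between-level lower p)) (between-refl (suc p))
withinᵇ-snake upper [] p (true  ∷ []) _ = trans (true-∧ (between-level upper p)) (between-refl (suc p))
withinᵇ-snake upper [] p (false ∷ []) _ = trans (true-∧ (between-level upper p)) (between-over (suc p) (suc p))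
withinᵇ-snake side (x ∷ core) p (b ∷ t) len = trans (true-∧ (between-level side p)) (step side x b)
  where
  next : ∀ side′ p′ →
    withinᵇ p′ (level side′ p′) (suc p′) (core ++ true ∷ []) (map not t) (core ++ false ∷ [])
      ≡ snakeRun side′ (core ++ true ∷ []) t
  next side′ p′ = withinᵇ-snake side′ core p′ t (suc-injective len)
  step : ∀ side x b →
    withinᵇ (stepHeight x p) (stepHeight (not b) (level side p)) (stepHeight x (suc p))
            (core ++ true ∷ []) (map not t) (core ++ false ∷ [])
      ≡ snakeRun side (x ∷ core ++ true ∷ []) (b ∷ t)
  step lower false true  = next lower p
  step lower false false = next upper p
  step lower true  true  = withinᵇ-fails (core ++ true ∷ []) _ _ (between-under p (suc (suc p)))
  step lower true  false = next lower (suc p)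
  step upper false true  = next upper p
  step upper false false = withinᵇ-fails (core ++ true ∷ []) _ _ (between-over p (suc p))
  step upper true  true  = next lower (suc p)
  step upper true  false = next upper (suc p)

withinᵇ-snake-start : ∀ core b (t : List Bool) → length t ≡ length (core ++ true ∷ []) →
  withinᵇ 0 0 0 (false ∷ core ++ true ∷ []) (map not (b ∷ t)) (true ∷ core ++ false ∷ [])
    ≡ snakeRun (startSide b) (core ++ true ∷ []) t
withinᵇ-snake-start core true  t len = withinᵇ-snake lower core 0 t len
withinᵇ-snake-start core false t len = withinᵇ-snake upper core 0 t len

Within-height : ∀ P C Q → Within 0 0 0 P C Q →
  length C ≡ length P → length Q ≡ length P → height Q ≡ height P → height C ≡ height P
Within-height P C Q w lenC lenQ hQ = ≤-antisym
  (subst₂ _≤_ (cong height (take-all _ C (≤-reflexive lenC)))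
              (trans (cong height (take-all _ Q (≤-reflexive lenQ))) hQ) cq)
  (subst₂ _≤_ (cong height (take-all _ P ≤-refl)) (cong height (take-all _ C (≤-reflexive lenC))) pc)
  where
  pc = proj₁ (w (length P) ≤-refl)
  cq = proj₂ (w (length P) ≤-refl)

∣p∣≡height : ∀ {n} (S : Subset n) → ∣ S ∣ ≡ height (toList S)
∣p∣≡height []          = refl
∣p∣≡height (true  ∷ S) = cong suc (∣p∣≡height S)
∣p∣≡height (false ∷ S) = ∣p∣≡height S

height-++-N : ∀ w → height (w ++ true ∷ []) ≡ suc (height (w ++ false ∷ []))
height-++-N []          = refl
height-++-N (true  ∷ w) = cong suc (height-++-N w)
height-++-N (false ∷ w) = height-++-N w

snake-dual-basis : ∀ core b (B : Subset (length (core ++ true ∷ []))) →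
  IsBasis (dual (LPM (false ∷ core ++ true ∷ []) (true ∷ core ++ false ∷ []))) (b ∷ B)
    ⇔ T (snakeRun (startSide b) (core ++ true ∷ []) (toList B))
snake-dual-basis core b B = mk⇔
  (λ (_ , w) → subst T run≡ (withinᵇ-complete P C Q w))
  (λ t → let w = withinᵇ-sound P C Q (subst T (sym run≡) t) in
         trans (∣p∣≡height (∁ (b ∷ B))) (Within-height P C Q w lenC lenQ (sym (height-++-N core))) , w)
  where
  P = false ∷ core ++ true ∷ []
  Q = true ∷ core ++ false ∷ []
  C = toList (∁ (b ∷ B))
  lenC : length C ≡ length P
  lenC = length-toList (∁ (b ∷ B))
  lenQ : length Q ≡ length P
  lenQ = cong suc (trans (length-++ core) (sym (length-++ core)))
  run≡ : withinᵇ 0 0 0 P C Q ≡ snakeRun (startSide b) (core ++ true ∷ []) (toList B)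
  run≡ = trans (cong (λ C′ → withinᵇ 0 0 0 P C′ Q) (toList-map not (b ∷ B)))
               (withinᵇ-snake-start core b (toList B) (length-toList B))

-- Multi-fans and snake words

fanWord : List ℕ → List ℕ → List Bool
fanWord []       ds       = []
fanWord (c ∷ cs) []       = replicate c true
fanWord (c ∷ cs) (d ∷ ds) = replicate c true ++ (replicate d false ++ fanWord cs ds)

fanGraph-spokes : ∀ v c w → replicate c (0 , v) ++ fanGraph v w ≡ fanGraph v (replicate c true ++ w)
fanGraph-spokes v zero    w = refl
fanGraph-spokes v (suc c) w = cong ((0 , v) ∷_) (fanGraph-spokes v c w)

fanGraph-rim : ∀ v d w → pathEdges v (suc v) d ++ fanGraph (v + d) w ≡ fanGraph v (replicate d false ++ w)
fanGraph-rim v zero    w = cong (λ u → fanGraph u w) (+-identityʳ v)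
fanGraph-rim v (suc d) w = cong ((v , suc v) ∷_)
  (trans (cong (λ u → pathEdges (suc v) (suc (suc v)) d ++ fanGraph u w) (+-suc v d)) (fanGraph-rim (suc v) d w))

fanEdges≡fanGraph : ∀ v cs ds → fanEdges v (suc v) cs ds ≡ fanGraph v (fanWord cs ds)
fanEdges≡fanGraph v []       ds       = refl
fanEdges≡fanGraph v (c ∷ cs) []       = begin
  replicate c (0 , v)                          ≡⟨ ++-identityʳ _ ⟨
  replicate c (0 , v) ++ []                    ≡⟨ fanGraph-spokes v c [] ⟩
  fanGraph v (replicate c true ++ [])          ≡⟨ cong (fanGraph v) (++-identityʳ _) ⟩
  fanGraph v (replicate c true)                ∎
  where open ≡-Reasoning
fanEdges≡fanGraph v (c ∷ cs) (d ∷ ds) = begin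
  replicate c (0 , v) ++ (pathEdges v (suc v) d ++ fanEdges (v + d) (suc (v + d)) cs ds)
    ≡⟨ cong (λ G → replicate c (0 , v) ++ (pathEdges v (suc v) d ++ G)) (fanEdges≡fanGraph (v + d) cs ds) ⟩
  replicate c (0 , v) ++ (pathEdges v (suc v) d ++ fanGraph (v + d) (fanWord cs ds))
    ≡⟨ cong (replicate c (0 , v) ++_) (fanGraph-rim v d (fanWord cs ds)) ⟩
  replicate c (0 , v) ++ fanGraph v (replicate d false ++ fanWord cs ds)
    ≡⟨ fanGraph-spokes v c (replicate d false ++ fanWord cs ds) ⟩
  fanGraph v (fanWord (c ∷ cs) (d ∷ ds)) ∎
  where open ≡-Reasoning

bundles : Bool → List ℕ → List ℕ
bundles true  e = dec e ++ 1 ∷ []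
bundles false e = initDec e

-- c′ without its first entry, when l lists the group lengths from an East group on.
bundlesAfter : List ℕ → List ℕ
bundlesAfter l = bundles (isOdd l) (evens l)

isOdd-∷-∷ : ∀ x y l → isOdd (x ∷ y ∷ l) ≡ isOdd l
isOdd-∷-∷ x y l with isOdd l
... | true  = refl
... | false = refl

bundles-∷ : ∀ b y w e → bundles b (y ∷ w ∷ e) ≡ (y ∸ 1) ∷ bundles b (w ∷ e)
bundles-∷ true  y w e = refl
bundles-∷ false y w e = refl

bundlesAfter-∷ : ∀ x y z r → bundlesAfter (x ∷ y ∷ z ∷ r) ≡ (y ∸ 1) ∷ bundlesAfter (z ∷ r)
bundlesAfter-∷ x y z r rewrite isOdd-∷-∷ x y (z ∷ r) = second-group r
  where
  second-group : ∀ r → bundles (isOdd (z ∷ r)) (y ∷ odds r) ≡ (y ∸ 1) ∷ bundles (isOdd (z ∷ r)) (odds r)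
  second-group []      = refl
  second-group (w ∷ r) = bundles-∷ (isOdd (z ∷ w ∷ r)) y w (evens r)

cPrime-rim : ∀ m rest → cPrime (suc (suc m)) rest ≡ 1 ∷ bundlesAfter (suc (suc m) ∷ rest)
cPrime-rim m rest with isOdd (suc (suc m) ∷ rest)
... | true  = refl
... | false = refl

cPrime-spoke : ∀ a₂ a₃ r → cPrime 1 (a₂ ∷ a₃ ∷ r) ≡ a₂ ∷ bundlesAfter (a₃ ∷ r)
cPrime-spoke a₂ a₃ r rewrite isOdd-∷-∷ 1 a₂ (a₃ ∷ r) with isOdd (a₃ ∷ r)
... | true  = refl
... | false = refl

replicate-∷ʳ : ∀ {A : Set} n (x : A) → replicate n x ++ x ∷ [] ≡ replicate (suc n) x
replicate-∷ʳ zero    x = refl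
replicate-∷ʳ (suc n) x = cong (x ∷_) (replicate-∷ʳ n x)

snakeCore≡fanWord : ∀ c₀ x r → All (2 ≤_) r →
  replicate c₀ true ++ (snakeCore false (x ∷ r) ++ true ∷ [])
    ≡ fanWord (c₀ ∷ bundlesAfter (x ∷ r)) (dec (odds (x ∷ r)))
snakeCore≡fanWord c₀ x [] _ =
  cong (λ u → replicate c₀ true ++ (u ++ true ∷ [])) (++-identityʳ (replicate (x ∸ 1) false))
snakeCore≡fanWord c₀ x (suc zero ∷ []) (s≤s () ∷ [])
snakeCore≡fanWord c₀ x (suc (suc k) ∷ []) _ = cong (replicate c₀ true ++_) (begin
  (replicate (x ∸ 1) false ++ (replicate (suc k) true ++ [])) ++ true ∷ []
    ≡⟨ cong (λ u → (replicate (x ∸ 1) false ++ u) ++ true ∷ []) (++-identityʳ _) ⟩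
  (replicate (x ∸ 1) false ++ replicate (suc k) true) ++ true ∷ []
    ≡⟨ ++-assoc (replicate (x ∸ 1) false) _ _ ⟩
  replicate (x ∸ 1) false ++ (replicate (suc k) true ++ true ∷ [])
    ≡⟨ cong (replicate (x ∸ 1) false ++_) (replicate-∷ʳ (suc k) true) ⟩
  replicate (x ∸ 1) false ++ replicate (suc (suc k)) true ∎)
  where open ≡-Reasoning
snakeCore≡fanWord c₀ x (y ∷ z ∷ r) (_ ∷ _ ∷ 2≤r) = begin
  replicate c₀ true ++ ((replicate (x ∸ 1) false ++ (replicate (y ∸ 1) true ++ rest)) ++ true ∷ [])
    ≡⟨ cong (replicate c₀ true ++_) (++-assoc (replicate (x ∸ 1) false) _ _) ⟩
  replicate c₀ true ++ (replicate (x ∸ 1) false ++ ((replicate (y ∸ 1) true ++ rest) ++ true ∷ []))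
    ≡⟨ cong (λ u → replicate c₀ true ++ (replicate (x ∸ 1) false ++ u)) (++-assoc (replicate (y ∸ 1) true) _ _) ⟩
  replicate c₀ true ++ (replicate (x ∸ 1) false ++ (replicate (y ∸ 1) true ++ (rest ++ true ∷ [])))
    ≡⟨ cong (λ u → replicate c₀ true ++ (replicate (x ∸ 1) false ++ u)) (snakeCore≡fanWord (y ∸ 1) z r 2≤r) ⟩
  fanWord (c₀ ∷ (y ∸ 1) ∷ bundlesAfter (z ∷ r)) (dec (odds (x ∷ y ∷ z ∷ r)))
    ≡⟨ cong (λ cs → fanWord (c₀ ∷ cs) (dec (odds (x ∷ y ∷ z ∷ r)))) (bundlesAfter-∷ x y z r) ⟨
  fanWord (c₀ ∷ bundlesAfter (x ∷ y ∷ z ∷ r)) (dec (odds (x ∷ y ∷ z ∷ r))) ∎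
  where
  open ≡-Reasoning
  rest = snakeCore false (z ∷ r)

snakeWord≡fanWord : ∀ a₁ rest → 1 ≤ a₁ → All (2 ≤_) rest → ¬ (rest ≡ [] × a₁ ≡ 1) →
  fanWord (cPrime a₁ rest) (dPrime a₁ rest) ≡ true ∷ snakeCore false (a₁ ∷ rest) ++ true ∷ []
snakeWord≡fanWord (suc (suc m)) rest _ 2≤rest _ =
  trans (cong (λ cs → fanWord cs (dPrime (suc (suc m)) rest)) (cPrime-rim m rest))
        (sym (snakeCore≡fanWord 1 (suc (suc m)) rest 2≤rest))
snakeWord≡fanWord 1 [] _ _ not-S1 = ⊥-elim (not-S1 (refl , refl))
snakeWord≡fanWord 1 (suc zero ∷ []) _ (s≤s () ∷ []) _
snakeWord≡fanWord 1 (suc (suc k) ∷ []) _ _ _ = cong (true ∷_) (begin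
  replicate (suc (suc k)) true                     ≡⟨ replicate-∷ʳ (suc k) true ⟨
  replicate (suc k) true ++ true ∷ []              ≡⟨ cong (_++ true ∷ []) (++-identityʳ (replicate (suc k) true)) ⟨
  (replicate (suc k) true ++ []) ++ true ∷ []      ∎)
  where open ≡-Reasoning
snakeWord≡fanWord 1 (suc k ∷ a₃ ∷ r) _ (_ ∷ _ ∷ 2≤r) _ = begin
  fanWord (cPrime 1 (suc k ∷ a₃ ∷ r)) (dec (odds (a₃ ∷ r)))
    ≡⟨ cong (λ cs → fanWord cs (dec (odds (a₃ ∷ r)))) (cPrime-spoke (suc k) a₃ r) ⟩
  fanWord (suc k ∷ bundlesAfter (a₃ ∷ r)) (dec (odds (a₃ ∷ r)))
    ≡⟨ snakeCore≡fanWord (suc k) a₃ r 2≤r ⟨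
  true ∷ replicate k true ++ (snakeCore false (a₃ ∷ r) ++ true ∷ [])
    ≡⟨ cong (true ∷_) (++-assoc (replicate k true) _ _) ⟨
  true ∷ (replicate k true ++ snakeCore false (a₃ ∷ r)) ++ true ∷ [] ∎
  where open ≡-Reasoning

length-fanGraph : ∀ v w → length (fanGraph v w) ≡ length w
length-fanGraph v []          = refl
length-fanGraph v (true  ∷ w) = cong suc (length-fanGraph v w)
length-fanGraph v (false ∷ w) = cong suc (length-fanGraph (suc v) w)

toList-tabulate-cast : ∀ {m n} (e : m ≡ n) (B : Vec Bool n) →
  toList (tabulate (λ j → vlookup B (cast e j))) ≡ toList B
toList-tabulate-cast e B = begin
  toList (tabulate (λ j → vlookup B (cast e j)))        ≡⟨ cong toList (tabulate-cong (lookup-cast₂ e B)) ⟩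
  toList (tabulate (vlookup (Vec.cast (sym e) B)))      ≡⟨ cong toList (tabulate∘lookup (Vec.cast (sym e) B)) ⟩
  toList (Vec.cast (sym e) B)                           ≡⟨ toList-cast (sym e) B ⟩
  toList B                                              ∎
  where open ≡-Reasoning

-- The isomorphism is the identity on positions: the i-th step of the snake word is
-- the i-th edge of the fan.
snake≅fan : ∀ core →
  dual (LPM (false ∷ core ++ true ∷ []) (true ∷ core ++ false ∷ []))
    ≅ cycleMatroid (fanGraph 1 (true ∷ core ++ true ∷ []))
snake≅fan core = σ , preserves
  where
  w = core ++ true ∷ []
  e : suc (length w) ≡ length (fanGraph 1 (true ∷ w))
  e = sym (length-fanGraph 1 (true ∷ w))
  σ : Fin (suc (length w)) ↔ Fin (length (fanGraph 1 (true ∷ w)))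
  σ = mk↔ₛ′ (cast e) (cast (sym e)) (cast-involutive e (sym e)) (cast-involutive (sym e) e)
  preserves : ∀ B → IsBasis (dual (LPM (false ∷ w) (true ∷ core ++ false ∷ []))) B
                  ⇔ IsBasis (cycleMatroid (fanGraph 1 (true ∷ w))) (image σ B)
  preserves (b ∷ B) =
    ⇔.trans (snake-dual-basis core b B)
            (⇔.trans (subst (λ x → T (snakeRun (startSide b) w (toList B)) ⇔ T x) run≡ ⇔.refl)
                     (⇔.sym (fanGraph-basis (true ∷ w) (image σ (b ∷ B)))))
    where
    run≡ : snakeRun (startSide b) w (toList B) ≡ fanBasisᵇ (true ∷ w) (toList (image σ (b ∷ B)))
    run≡ = trans (sym (fanBasisᵇ-spoke w b (toList B)))
                 (cong (fanBasisᵇ (true ∷ w)) (sym (toList-tabulate-cast (sym e) (b ∷ B))))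

corollary3p3 : (a₁ : ℕ) (rest : List ℕ) →
    1 ≤ a₁ → All (2 ≤_) rest → ¬ (rest ≡ [] × a₁ ≡ 1) →
    dual (snake (a₁ ∷ rest)) ≅ cycleMatroid (multiFan (cPrime a₁ rest) (dPrime a₁ rest))
corollary3p3 a₁ rest 1≤a₁ 2≤rest not-S1 =
  subst (λ G → dual (snake (a₁ ∷ rest)) ≅ cycleMatroid G) (sym multiFan≡)
        (snake≅fan (snakeCore false (a₁ ∷ rest)))
  where
  multiFan≡ : multiFan (cPrime a₁ rest) (dPrime a₁ rest)
              ≡ fanGraph 1 (true ∷ snakeCore false (a₁ ∷ rest) ++ true ∷ [])
  multiFan≡ = trans (fanEdges≡fanGraph 1 (cPrime a₁ rest) (dPrime a₁ rest))
                    (cong (fanGraph 1) (snakeWord≡fanWord a₁ rest 1≤a₁ 2≤rest not-S1))
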